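{- Let $\mathbb{A}$ be the Fraïssé limit of the class of all totally ordered expansions of structures in a free amalgamation class $\mathscr{C}_0$ of finite irreflexive $\sigma_0$-structures, where $\sigma_0$ is a finite vocabulary of unary and binary relations. Let $S\subseteq\mathbb{A}$ be finite, $I\subseteq\mathbb{Q}$ finite, $\mathcal{O}\subseteq\mathbb{A}^I$ an $S$-ordered orbit and $a\parallel b$ an $\mathcal{O}$-duo. Let $z\in S$, put $S'=S\setminus\{z\}$, and let $j\in\mathbb{Q}\setminus I$ be such that the combined tuple $az\in\mathbb{A}^{I\cup\{j\}}$ is $S'$-ordered; let $\mathcal{O}'=\operatorname{Aut}(\mathbb{A}/S')\cdot az$. Let $X\subseteq\mathbb{A}$ be a finite set containing $\{a_i,b_i: i\in I\}\cup S'$ but not $z$, let $Y\subseteq\mathbb{A}$ be any finite set such that $X,Y,\{z\}$ are pairwise disjoint, and let $\tau\in\operatorname{Aut}(\mathbb{A})$ fix $X$ pointwise, with $\tau(z)>z$ and $\tau(z)$ unrelated to $z$ and to all elements of $Y$. Then, with $z'=\tau(z)$, the pair $az\parallel bz'$ is an $\mathcal{O}'$-duo.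
   Context: Elements $x,y$ are related if $x=y$ or $R(x,y)$ or $R(y,x)$ for some binary $R\in\sigma_0$. Irreflexive: $R(x,y)\Rightarrow x\neq y$ for binary $R\in\sigma_0$. A free amalgamation class is $\operatorname{Forb}(\mathscr{F})$ (finite $\sigma_0$-structures embedding no member of $\mathscr{F}$) where in each member of $\mathscr{F}$ every two elements are related. For a finite totally ordered index set $I\subseteq\mathbb{Q}$, a tuple $a\in\mathbb{A}^I$ is $S$-ordered if $a_i\notin S$ for all $i$ and $a_i<a_j$ whenever $i<j$; an $S$-ordered orbit is an orbit $\operatorname{Aut}(\mathbb{A}/S)\cdot a$ of an $S$-ordered tuple ($\operatorname{Aut}(\mathbb{A}/S)$: automorphisms fixing $S$ pointwise). For disjoint $I,J$ and $a\in\mathbb{A}^I$, $b\in\mathbb{A}^J$, $ab\in\mathbb{A}^{I\cup J}$ denotes the combined tuple. For an $S$-ordered orbit $\mathcal{O}\subseteq\mathbb{A}^I$, an $\mathcal{O}$-duo $a\parallel b$ is a pair $a,b\in\mathcal{O}$ with (1) $a_i<b_i$ for all $i\in I$; (2) $b_i<a_j$ for all $i<j$ in $I$; (3) for every binary $R\in\sigma_0$ and $i,j\in I$: $R(a_i,b_j)\iff R(a_i,a_j)\iff R(b_i,b_j)\iff R(b_i,a_j)$. -}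

module Defs where

open import Data.Nat using (ℕ)
open import Data.Bool using (Bool; true; false; if_then_else_)
open import Data.Fin using (Fin) renaming (_<_ to _<ᶠ_)
open import Data.Product using (Σ; ∃; _×_; _,_)
open import Data.Sum using (_⊎_)
open import Data.List using (List)
open import Data.List.Membership.Propositional using (_∈_)
open import Data.Rational using (ℚ; _≟_) renaming (_<_ to _<ℚ_)
open import Relation.Nullary using (¬_; ⌊_⌋)
open import Relation.Binary.PropositionalEquality using (_≡_)
open import Relation.Binary.Structures using (IsStrictTotalOrder)

-- Vocabulary σ₀: nU unary symbols (Fin nU) and nB binary symbols (Fin nB).

record FinStr (nU nB : ℕ) : Set where
  field
    size : ℕ
    un   : Fin nU → Fin size → Bool
    bin  : Fin nB → Fin size → Fin size → Bool
open FinStr public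

module _ {nU nB : ℕ} where

  Embedding : FinStr nU nB → FinStr nU nB → Set
  Embedding F G = Σ (Fin (size F) → Fin (size G)) λ f →
      (∀ x y → f x ≡ f y → x ≡ y)
    × (∀ U x → un F U x ≡ un G U (f x))
    × (∀ R x y → bin F R x y ≡ bin G R (f x) (f y))

  CompleteFS : FinStr nU nB → Set
  CompleteFS F = ∀ x y → x ≡ y ⊎ (∃ λ R → bin F R x y ≡ true ⊎ bin F R y x ≡ true)

  IrreflexiveFS : FinStr nU nB → Set
  IrreflexiveFS F = ∀ R x → bin F R x x ≡ false

  -- 𝒞₀ = irreflexive members of Forb(𝓕)
  InC0 : (FinStr nU nB → Set) → FinStr nU nB → Set
  InC0 𝓕 G = IrreflexiveFS G × (∀ F → 𝓕 F → ¬ Embedding F G)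

record Structure (nU nB : ℕ) : Set₁ where
  field
    Carrier : Set
    _<_     : Carrier → Carrier → Set
    <-sto   : IsStrictTotalOrder _≡_ _<_
    unA     : Fin nU → Carrier → Bool
    binA    : Fin nB → Carrier → Carrier → Bool
open Structure public

module _ {nU nB : ℕ} where

  record Aut (𝔸 : Structure nU nB) : Set where
    field
      to       : Carrier 𝔸 → Carrier 𝔸
      from     : Carrier 𝔸 → Carrier 𝔸
      to-from  : ∀ x → to (from x) ≡ x
      from-to  : ∀ x → from (to x) ≡ x
      pres-<   : ∀ x y → _<_ 𝔸 x y → _<_ 𝔸 (to x) (to y)
      refl-<   : ∀ x y → _<_ 𝔸 (to x) (to y) → _<_ 𝔸 x y
      pres-un  : ∀ U x → unA 𝔸 U x ≡ unA 𝔸 U (to x)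
      pres-bin : ∀ R x y → binA 𝔸 R x y ≡ binA 𝔸 R (to x) (to y)
  open Aut public

  induced : (𝔸 : Structure nU nB) (n : ℕ) → (Fin n → Carrier 𝔸) → FinStr nU nB
  induced 𝔸 n u = record
    { size = n
    ; un = λ U x → unA 𝔸 U (u x)
    ; bin = λ R x y → binA 𝔸 R (u x) (u y) }

  StrictlyIncreasing : (𝔸 : Structure nU nB) {n : ℕ} → (Fin n → Carrier 𝔸) → Set
  StrictlyIncreasing 𝔸 u = ∀ x y → x <ᶠ y → _<_ 𝔸 (u x) (u y)

  -- 𝔸 is the Fraïssé limit of the class of all totally ordered expansions
  -- of structures in 𝒞₀ (finite ordered structures are represented, up to
  -- isomorphism, by a σ₀-structure on Fin n with the natural order of Fin n).
  record IsFraisseLimit (𝓕 : FinStr nU nB → Set) (𝔸 : Structure nU nB) : Set where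
    field
      countable : Σ (ℕ → Carrier 𝔸) λ e → ∀ x → ∃ λ k → e k ≡ x
      age⊆      : ∀ n (u : Fin n → Carrier 𝔸) → StrictlyIncreasing 𝔸 u →
                  InC0 𝓕 (induced 𝔸 n u)
      age⊇      : ∀ (G : FinStr nU nB) → InC0 𝓕 G →
                  Σ (Fin (size G) → Carrier 𝔸) λ u → StrictlyIncreasing 𝔸 u
                    × (∀ U x → un G U x ≡ unA 𝔸 U (u x))
                    × (∀ R x y → bin G R x y ≡ binA 𝔸 R (u x) (u y))
      homogeneous : ∀ n (u v : Fin n → Carrier 𝔸) →
                  (∀ x y → u x ≡ u y → x ≡ y) →
                  (∀ x y → _<_ 𝔸 (u x) (u y) → _<_ 𝔸 (v x) (v y)) →
                  (∀ U x → unA 𝔸 U (u x) ≡ unA 𝔸 U (v x)) →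
                  (∀ R x y → binA 𝔸 R (u x) (u y) ≡ binA 𝔸 R (v x) (v y)) →
                  Σ (Aut 𝔸) λ σ → ∀ x → to σ (u x) ≡ v x

  Related : (𝔸 : Structure nU nB) → Carrier 𝔸 → Carrier 𝔸 → Set
  Related 𝔸 x y = x ≡ y ⊎ (∃ λ R → binA 𝔸 R x y ≡ true ⊎ binA 𝔸 R y x ≡ true)

  -- Tuples indexed by a finite I ⊆ ℚ: represented as total maps ℚ → 𝔸,
  -- of which only the values on I (a List ℚ) are ever used.
  Tuple : Structure nU nB → Set
  Tuple 𝔸 = ℚ → Carrier 𝔸

  extend : (𝔸 : Structure nU nB) → Tuple 𝔸 → ℚ → Carrier 𝔸 → Tuple 𝔸
  extend 𝔸 a j z i = if ⌊ i ≟ j ⌋ then z else a i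

  SOrdered : (𝔸 : Structure nU nB) → (Carrier 𝔸 → Set) → List ℚ → Tuple 𝔸 → Set
  SOrdered 𝔸 S I a = (∀ i → i ∈ I → ¬ S (a i))
                   × (∀ i j → i ∈ I → j ∈ I → i <ℚ j → _<_ 𝔸 (a i) (a j))

  InOrbit : (𝔸 : Structure nU nB) → (Carrier 𝔸 → Set) → List ℚ → Tuple 𝔸 → Tuple 𝔸 → Set
  InOrbit 𝔸 S I a c = Σ (Aut 𝔸) λ σ → (∀ x → S x → to σ x ≡ x)
                                     × (∀ i → i ∈ I → to σ (a i) ≡ c i)

  IsSOrderedOrbit : (𝔸 : Structure nU nB) → (Carrier 𝔸 → Set) → List ℚ → (Tuple 𝔸 → Set) → Set
  IsSOrderedOrbit 𝔸 S I 𝒪 = Σ (Tuple 𝔸) λ a₀ → SOrdered 𝔸 S I a₀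
     × (∀ c → (𝒪 c → InOrbit 𝔸 S I a₀ c) × (InOrbit 𝔸 S I a₀ c → 𝒪 c))

  Duo : (𝔸 : Structure nU nB) → List ℚ → (Tuple 𝔸 → Set) → Tuple 𝔸 → Tuple 𝔸 → Set
  Duo 𝔸 I 𝒪 a b = 𝒪 a × 𝒪 b
    × (∀ i → i ∈ I → _<_ 𝔸 (a i) (b i))
    × (∀ i j → i ∈ I → j ∈ I → i <ℚ j → _<_ 𝔸 (b i) (a j))
    × (∀ R i j → i ∈ I → j ∈ I →
         (binA 𝔸 R (a i) (b j) ≡ binA 𝔸 R (a i) (a j))
       × (binA 𝔸 R (a i) (a j) ≡ binA 𝔸 R (b i) (b j))
       × (binA 𝔸 R (b i) (b j) ≡ binA 𝔸 R (b i) (a j)))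

-- Since a and b lie in the same Aut(𝔸/S)-orbit, some ρ fixing S maps a to b;
-- ρ fixes z, and τ ∘ ρ fixes S′ and maps a z to b z′, so b z′ ∈ 𝒪′. The order and
-- relation conditions at the new coordinate are transported along ρ (which fixes
-- z and moves a to b) and τ (which fixes a and b and moves z to z′); between z
-- and z′ themselves they hold because z, z′ are unrelated and 𝔸 is irreflexive.
module Submission where

open import Defs
open import Data.Nat using (ℕ)
open import Data.Bool using (false)
open import Data.Bool.Properties using (¬-not)
open import Data.Fin using (Fin; zero)
open import Data.Product using (_×_; _,_; proj₁; proj₂)
open import Data.Sum using (inj₁; inj₂)
open import Data.List using (List; _∷_)
open import Data.List.Membership.Propositional using (_∈_; _∉_)
open import Data.List.Relation.Unary.Any using (here; there)
open import Data.Rational using (ℚ; _≟_) renaming (_<_ to _<ℚ_)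
open import Data.Rational.Properties using (<-irrefl)
open import Data.Empty using (⊥-elim)
open import Relation.Nullary using (¬_; yes; no)
open import Relation.Binary.PropositionalEquality
  using (_≡_; _≢_; refl; sym; trans; cong; cong₂; subst₂; module ≡-Reasoning)

∉⇒≢ : ∀ {A : Set} {x y : A} {xs : List A} → y ∉ xs → x ∈ xs → x ≢ y
∉⇒≢ y∉xs x∈xs refl = y∉xs x∈xs

module _ {nU nB : ℕ} {𝔸 : Structure nU nB} where

  private
    A = Carrier 𝔸
    _<ᴬ_ = _<_ 𝔸

  Aut-id : Aut 𝔸
  Aut-id = record
    { to = λ x → x ; from = λ x → x ; to-from = λ _ → refl ; from-to = λ _ → refl
    ; pres-< = λ _ _ p → p ; refl-< = λ _ _ p → p
    ; pres-un = λ _ _ → refl ; pres-bin = λ _ _ _ → refl }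

  Aut-inverse : Aut 𝔸 → Aut 𝔸
  Aut-inverse σ = record
    { to = from σ ; from = to σ ; to-from = from-to σ ; from-to = to-from σ
    ; pres-< = λ x y p → refl-< σ _ _ (subst₂ _<ᴬ_ (sym (to-from σ x)) (sym (to-from σ y)) p)
    ; refl-< = λ x y p → subst₂ _<ᴬ_ (to-from σ x) (to-from σ y) (pres-< σ _ _ p)
    ; pres-un = λ U x → sym (trans (pres-un σ U (from σ x)) (cong (unA 𝔸 U) (to-from σ x)))
    ; pres-bin = λ R x y → sym (trans (pres-bin σ R (from σ x) (from σ y))
                                      (cong₂ (binA 𝔸 R) (to-from σ x) (to-from σ y))) }

  infixr 9 _∘ᴬ_
  _∘ᴬ_ : Aut 𝔸 → Aut 𝔸 → Aut 𝔸
  σ ∘ᴬ τ = record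
    { to = λ x → to σ (to τ x) ; from = λ x → from τ (from σ x)
    ; to-from = λ x → trans (cong (to σ) (to-from τ (from σ x))) (to-from σ x)
    ; from-to = λ x → trans (cong (from τ) (from-to σ (to τ x))) (from-to τ x)
    ; pres-< = λ x y p → pres-< σ _ _ (pres-< τ _ _ p)
    ; refl-< = λ x y p → refl-< τ _ _ (refl-< σ _ _ p)
    ; pres-un = λ U x → trans (pres-un τ U x) (pres-un σ U (to τ x))
    ; pres-bin = λ R x y → trans (pres-bin τ R x y) (pres-bin σ R (to τ x) (to τ y)) }

  to≡⇒from≡ : (σ : Aut 𝔸) {x y : A} → to σ x ≡ y → from σ y ≡ x
  to≡⇒from≡ σ {x} refl = from-to σ x

  Aut-< : (σ : Aut 𝔸) {x y x′ y′ : A} → to σ x ≡ x′ → to σ y ≡ y′ → x <ᴬ y → x′ <ᴬ y′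
  Aut-< σ refl refl = pres-< σ _ _

  Aut-binA : (σ : Aut 𝔸) (R : Fin nB) {x y x′ y′ : A} →
             to σ x ≡ x′ → to σ y ≡ y′ → binA 𝔸 R x y ≡ binA 𝔸 R x′ y′
  Aut-binA σ R refl refl = pres-bin σ R _ _

  ¬Related⇒binA-false : ∀ {x y} → ¬ Related 𝔸 x y → ∀ R → binA 𝔸 R x y ≡ false
  ¬Related⇒binA-false x≁y R = ¬-not λ e → x≁y (inj₂ (R , inj₁ e))

  ¬Related⇒binA-false′ : ∀ {x y} → ¬ Related 𝔸 x y → ∀ R → binA 𝔸 R y x ≡ false
  ¬Related⇒binA-false′ x≁y R = ¬-not λ e → x≁y (inj₂ (R , inj₂ e))

  binA-irreflexive : ∀ {𝓕} → IsFraisseLimit 𝓕 𝔸 → ∀ R x → binA 𝔸 R x x ≡ false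
  binA-irreflexive FL R x =
    proj₁ (IsFraisseLimit.age⊆ FL 1 (λ _ → x) (λ { zero zero () })) R zero

  module _ {S : A → Set} {J : List ℚ} where

    InOrbit-refl : ∀ c → InOrbit 𝔸 S J c c
    InOrbit-refl c = Aut-id , (λ _ _ → refl) , (λ _ _ → refl)

    InOrbit-sym : ∀ {c d} → InOrbit 𝔸 S J c d → InOrbit 𝔸 S J d c
    InOrbit-sym (σ , fixes , moves) =
      Aut-inverse σ , (λ x s → to≡⇒from≡ σ (fixes x s)) , (λ i p → to≡⇒from≡ σ (moves i p))

    InOrbit-trans : ∀ {c d e} → InOrbit 𝔸 S J c d → InOrbit 𝔸 S J d e → InOrbit 𝔸 S J c e
    InOrbit-trans (σ , σ-fixes , σ-moves) (τ , τ-fixes , τ-moves) =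
        τ ∘ᴬ σ
      , (λ x s → trans (cong (to τ) (σ-fixes x s)) (τ-fixes x s))
      , (λ i p → trans (cong (to τ) (σ-moves i p)) (τ-moves i p))

    InOrbit-binA : ∀ {c d} → InOrbit 𝔸 S J c d → ∀ R {i k} → i ∈ J → k ∈ J →
                   binA 𝔸 R (c i) (c k) ≡ binA 𝔸 R (d i) (d k)
    InOrbit-binA (σ , _ , moves) R p q = Aut-binA σ R (moves _ p) (moves _ q)

  SOrderedOrbit⇒InOrbit : ∀ {S I 𝒪 c d} → IsSOrderedOrbit 𝔸 S I 𝒪 → 𝒪 c → 𝒪 d →
                          InOrbit 𝔸 S I c d
  SOrderedOrbit⇒InOrbit (_ , _ , orbit) 𝒪c 𝒪d =
    InOrbit-trans (InOrbit-sym (proj₁ (orbit _) 𝒪c)) (proj₁ (orbit _) 𝒪d)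

  extend-here : ∀ a j z → extend 𝔸 a j z j ≡ z
  extend-here a j z with j ≟ j
  ... | yes _  = refl
  ... | no j≢j = ⊥-elim (j≢j refl)

  extend-there : ∀ a {j} z {i} → i ≢ j → extend 𝔸 a j z i ≡ a i
  extend-there a {j} z {i} i≢j with i ≟ j
  ... | yes i≡j = ⊥-elim (i≢j i≡j)
  ... | no _    = refl

  module _ {I : List ℚ} {j : ℚ} (j∉I : j ∉ I) where

    InOrbit-extend : ∀ {S a b z z′} (σ : Aut 𝔸) → (∀ x → S x → to σ x ≡ x) →
                     (∀ i → i ∈ I → to σ (a i) ≡ b i) → to σ z ≡ z′ →
                     InOrbit 𝔸 S (j ∷ I) (extend 𝔸 a j z) (extend 𝔸 b j z′)
    InOrbit-extend {a = a} {b} {z} {z′} σ fixes moves σz≡z′ = σ , fixes , moves′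
      where
      moves′ : ∀ i → i ∈ j ∷ I → to σ (extend 𝔸 a j z i) ≡ extend 𝔸 b j z′ i
      moves′ i (here refl) rewrite extend-here a j z | extend-here b j z′ = σz≡z′
      moves′ i (there p)
        rewrite extend-there a z (∉⇒≢ j∉I p) | extend-there b z′ (∉⇒≢ j∉I p) = moves i p

    module _ {a z} (increasing : ∀ i k → i ∈ j ∷ I → k ∈ j ∷ I → i <ℚ k →
                                   extend 𝔸 a j z i <ᴬ extend 𝔸 a j z k) where

      extend-below : ∀ i → i ∈ I → i <ℚ j → a i <ᴬ z
      extend-below i p i<j = subst₂ _<ᴬ_ (extend-there a z (∉⇒≢ j∉I p)) (extend-here a j z)
                                        (increasing i j (there p) (here refl) i<j)

      extend-above : ∀ k → k ∈ I → j <ℚ k → z <ᴬ a k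
      extend-above k q j<k = subst₂ _<ᴬ_ (extend-here a j z) (extend-there a z (∉⇒≢ j∉I q))
                                        (increasing j k (here refl) (there q) j<k)

    Duo-extend :
      ∀ {𝒪 S a b z z′} → (∀ R x → binA 𝔸 R x x ≡ false) → Duo 𝔸 I 𝒪 a b →
      InOrbit 𝔸 S (j ∷ I) (extend 𝔸 a j z) (extend 𝔸 b j z′) →
      z <ᴬ z′ → ¬ Related 𝔸 z z′ →
      (∀ i → i ∈ I → i <ℚ j → b i <ᴬ z) → (∀ k → k ∈ I → j <ℚ k → z′ <ᴬ a k) →
      (∀ R k → k ∈ I → binA 𝔸 R z (b k) ≡ binA 𝔸 R z (a k)
                     × binA 𝔸 R z′ (b k) ≡ binA 𝔸 R z′ (a k)) →
      (∀ R i → i ∈ I → binA 𝔸 R (a i) z′ ≡ binA 𝔸 R (a i) z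
                     × binA 𝔸 R (b i) z′ ≡ binA 𝔸 R (b i) z) →
      Duo 𝔸 (j ∷ I) (InOrbit 𝔸 S (j ∷ I) (extend 𝔸 a j z)) (extend 𝔸 a j z) (extend 𝔸 b j z′)
    Duo-extend {a = a} {b} {z} {z′} irreflexive (_ , _ , a<b , b<a , duo-rel) orbit
               z<z′ z≁z′ below above new-vs-old old-vs-new =
      InOrbit-refl c , orbit , increasing , alternating , relations
      where
      c d : Tuple 𝔸
      c = extend 𝔸 a j z
      d = extend 𝔸 b j z′

      c-here : c j ≡ z
      c-here = extend-here a j z
      d-here : d j ≡ z′
      d-here = extend-here b j z′
      c-there : ∀ {i} → i ∈ I → c i ≡ a i
      c-there p = extend-there a z (∉⇒≢ j∉I p)
      d-there : ∀ {i} → i ∈ I → d i ≡ b i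
      d-there p = extend-there b z′ (∉⇒≢ j∉I p)

      increasing : ∀ i → i ∈ j ∷ I → c i <ᴬ d i
      increasing i (here refl) rewrite c-here | d-here = z<z′
      increasing i (there p) rewrite c-there p | d-there p = a<b i p

      alternating : ∀ i k → i ∈ j ∷ I → k ∈ j ∷ I → i <ℚ k → d i <ᴬ c k
      alternating i k (here refl) (here refl) j<j = ⊥-elim (<-irrefl refl j<j)
      alternating i k (here refl) (there q) j<k rewrite d-here | c-there q = above k q j<k
      alternating i k (there p) (here refl) i<j rewrite d-there p | c-here = below i p i<j
      alternating i k (there p) (there q) i<k rewrite d-there p | c-there q = b<a i k p q i<k

      cross : ∀ R {i k} → i ∈ j ∷ I → k ∈ j ∷ I →
              binA 𝔸 R (c i) (d k) ≡ binA 𝔸 R (c i) (c k)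
            × binA 𝔸 R (d i) (d k) ≡ binA 𝔸 R (d i) (c k)
      cross R (here refl) (here refl) rewrite c-here | d-here =
          trans (¬Related⇒binA-false z≁z′ R) (sym (irreflexive R z))
        , trans (irreflexive R z′) (sym (¬Related⇒binA-false′ z≁z′ R))
      cross R (here refl) (there q) rewrite c-here | d-here | c-there q | d-there q =
        new-vs-old R _ q
      cross R (there p) (here refl) rewrite c-here | d-here | c-there p | d-there p =
        old-vs-new R _ p
      cross R (there p) (there q) rewrite c-there p | d-there p | c-there q | d-there q =
        proj₁ (duo-rel R _ _ p q) , proj₂ (proj₂ (duo-rel R _ _ p q))

      relations : ∀ R i k → i ∈ j ∷ I → k ∈ j ∷ I →
                  binA 𝔸 R (c i) (d k) ≡ binA 𝔸 R (c i) (c k)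
                × binA 𝔸 R (c i) (c k) ≡ binA 𝔸 R (d i) (d k)
                × binA 𝔸 R (d i) (d k) ≡ binA 𝔸 R (d i) (c k)
      relations R i k p q =
        proj₁ (cross R p q) , InOrbit-binA orbit R p q , proj₂ (cross R p q)

lemma8p8 : ∀ {nU nB : ℕ} (𝓕 : FinStr nU nB → Set) → (∀ F → 𝓕 F → CompleteFS F) →
    (𝔸 : Structure nU nB) → IsFraisseLimit 𝓕 𝔸 →
    (S : List (Carrier 𝔸)) (I : List ℚ) (𝒪 : Tuple 𝔸 → Set) →
    IsSOrderedOrbit 𝔸 (λ x → x ∈ S) I 𝒪 →
    (a b : Tuple 𝔸) → Duo 𝔸 I 𝒪 a b →
    (z : Carrier 𝔸) → z ∈ S →
    (j : ℚ) → j ∉ I →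
    SOrdered 𝔸 (λ x → x ∈ S × x ≢ z) (j ∷ I) (extend 𝔸 a j z) →
    (X Y : List (Carrier 𝔸)) →
    (∀ i → i ∈ I → a i ∈ X) → (∀ i → i ∈ I → b i ∈ X) →
    (∀ x → x ∈ S → x ≢ z → x ∈ X) → z ∉ X →
    (∀ x → x ∈ X → x ∉ Y) → z ∉ Y →
    (τ : Aut 𝔸) → (∀ x → x ∈ X → to τ x ≡ x) →
    _<_ 𝔸 z (to τ z) → ¬ Related 𝔸 z (to τ z) →
    (∀ y → y ∈ Y → ¬ Related 𝔸 (to τ z) y) →
    Duo 𝔸 (j ∷ I) (InOrbit 𝔸 (λ x → x ∈ S × x ≢ z) (j ∷ I) (extend 𝔸 a j z))
    (extend 𝔸 a j z) (extend 𝔸 b j (to τ z))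
lemma8p8 _ _ 𝔸 FL S I 𝒪 𝒪-orbit a b duo@(𝒪a , 𝒪b , _) z z∈S j j∉I (_ , increasing) X Y a∈X b∈X S′⊆X _ _ _
         τ τ-fixes z<z′ z≁z′ _ =
  Duo-extend j∉I (binA-irreflexive FL) duo
    (InOrbit-extend j∉I (τ ∘ᴬ ρ) fixes-S′ moves-a (cong (to τ) ρ-fixes-z))
    z<z′ z≁z′
    (λ i p i<j → Aut-< ρ (ρ-moves p) ρ-fixes-z (extend-below {𝔸 = 𝔸} j∉I increasing i p i<j))
    (λ k q j<k → Aut-< τ refl (τ-fixes-a q) (extend-above {𝔸 = 𝔸} j∉I increasing k q j<k))
    (λ R k q → sym (Aut-binA ρ R ρ-fixes-z (ρ-moves q)) , z′-sees-a-as-b R q)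
    (λ R i p → sym (Aut-binA τ R (τ-fixes-a p) refl) , sym (Aut-binA τ R (τ-fixes-b p) refl))
  where
  ρ-orbit : InOrbit 𝔸 (_∈ S) I a b
  ρ-orbit = SOrderedOrbit⇒InOrbit 𝒪-orbit 𝒪a 𝒪b

  ρ : Aut 𝔸
  ρ = proj₁ ρ-orbit

  z′ : Carrier 𝔸
  z′ = to τ z

  ρ-fixes-z : to ρ z ≡ z
  ρ-fixes-z = proj₁ (proj₂ ρ-orbit) z z∈S

  ρ-moves : ∀ {i} → i ∈ I → to ρ (a i) ≡ b i
  ρ-moves = proj₂ (proj₂ ρ-orbit) _

  τ-fixes-a : ∀ {i} → i ∈ I → to τ (a i) ≡ a i
  τ-fixes-a p = τ-fixes _ (a∈X _ p)

  τ-fixes-b : ∀ {i} → i ∈ I → to τ (b i) ≡ b i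
  τ-fixes-b p = τ-fixes _ (b∈X _ p)

  fixes-S′ : ∀ x → x ∈ S × x ≢ z → to τ (to ρ x) ≡ x
  fixes-S′ x (x∈S , x≢z) =
    trans (cong (to τ) (proj₁ (proj₂ ρ-orbit) x x∈S)) (τ-fixes x (S′⊆X x x∈S x≢z))

  moves-a : ∀ i → i ∈ I → to τ (to ρ (a i)) ≡ b i
  moves-a i p = trans (cong (to τ) (ρ-moves p)) (τ-fixes-b p)

  z′-sees-a-as-b : ∀ R {k} → k ∈ I → binA 𝔸 R z′ (b k) ≡ binA 𝔸 R z′ (a k)
  z′-sees-a-as-b R {k} q = begin
    binA 𝔸 R z′ (b k)  ≡⟨ sym (Aut-binA τ R refl (τ-fixes-b q)) ⟩
    binA 𝔸 R z (b k)   ≡⟨ sym (Aut-binA ρ R ρ-fixes-z (ρ-moves q)) ⟩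
    binA 𝔸 R z (a k)   ≡⟨ Aut-binA τ R refl (τ-fixes-a q) ⟩
    binA 𝔸 R z′ (a k)  ∎
    where open ≡-Reasoning
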